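{- Let $T$ be an endofunctor on $\textbf{Fuzzy-Top}$ and $\Sigma$ a monotone fuzzy geometric modal signature for $T$. Then every Aczel–Mendler bisimulation between fuzzy geometric models $(B_1,\gamma_1,\mathcal{V}_{B_1})$ and $(B_2,\gamma_2,\mathcal{V}_{B_2})$ for $T$ is a $\Sigma$-bisimulation between them.
   Context: $\textbf{Fuzzy-Top}$: fuzzy topological spaces ($\tau_S$ a family of maps $S\to[0,1]$ containing constants $0,1$, closed under finite pointwise minima and arbitrary suprema) and fuzzy continuous maps. $\mathcal{Q}(S)=\tau_S$, $\mathcal{Q}(f)=f^{ -1}:\mu\mapsto\mu\circ f$. An $n$-ary fuzzy-open predicate lifting is a natural transformation $\lambda:\mathcal{Q}^n\to\mathcal{Q}\circ T$ ($\lambda_S(\mu_1\circ f,\dots,\mu_n\circ f)=\lambda_K(\mu_1,\dots,\mu_n)\circ Tf$); it is monotone if $\mu_i\le\eta_i$ for all $i$ implies $\lambda_S(\mu_1,\dots,\mu_n)\le\lambda_S(\eta_1,\dots,\eta_n)$; $\Sigma$ is a set of liftings, monotone if all members are. A fuzzy geometric model is $(B,\gamma,\mathcal{V}_B)$ with $\gamma:B\to TB$ a morphism and $\mathcal{V}_B:\Phi\to\mathcal{Q}(B)$ for a fixed set $\Phi$ of propositional variables. A relation $\mathcal{R}\subseteq B_1\times B_2$ is an Aczel–Mendler bisimulation if $\mathcal{V}_{B_1}(p)(b_1)=\mathcal{V}_{B_2}(p)(b_2)$ for all $(b_1,b_2)\in\mathcal{R}$ and $p\in\Phi$, and $\mathcal{R}$,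 as an object of $\textbf{Fuzzy-Top}$ with projections $\pi_1,\pi_2$ fuzzy continuous, carries a morphism $\gamma^*:\mathcal{R}\to T\mathcal{R}$ with $\gamma_1\circ\pi_1=T\pi_1\circ\gamma^*$ and $\gamma_2\circ\pi_2=T\pi_2\circ\gamma^*$. For fuzzy sets: $\mathcal{R}[\mu](d')=\sup\{\mu(d):d\mathcal{R}d'\}$, $\mathcal{R}^{ -1}[\eta](d)=\sup\{\eta(d'):d\mathcal{R}d'\}$. $\mathcal{R}$ is a $\Sigma$-bisimulation if for all $(b_1,b_2)\in\mathcal{R}$: (i) $\mathcal{V}_{B_1}(p)(b_1)=\mathcal{V}_{B_2}(p)(b_2)$ for all $p$; (ii) for every $n$-ary $\lambda\in\Sigma$ and $\mu_i\in\mathcal{Q}(B_1)$, $\eta_i\in\mathcal{Q}(B_2)$ with $\mathcal{R}[\mu_i]\le\eta_i$, $\mathcal{R}^{ -1}[\eta_i]\le\mu_i$, $\lambda_{B_1}(\mu_1,\dots,\mu_n)(\gamma_1(b_1))=\lambda_{B_2}(\eta_1,\dots,\eta_n)(\gamma_2(b_2))$. -}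

module Defs where

open import Level using (0ℓ)
open import Data.Nat using (ℕ)
open import Data.Fin using (Fin)
open import Data.Product using (Σ; Σ-syntax; _×_; _,_; proj₁; proj₂)
open import Relation.Binary.PropositionalEquality using (_≡_)
open import Function using (_∘_; id)

-- The stdlib has no real numbers, so the
-- unit interval is axiomatised abstractly by the structure the paper uses:
-- a partial order with bottom 0, top 1, binary meets (pointwise minima) and
-- arbitrary (Set-indexed) suprema.  The real unit interval is an instance.
record UnitInterval : Set₁ where
  infix 4 _≤_
  infixr 7 _⊓_
  field
    Carrier : Set
    _≤_     : Carrier → Carrier → Set
    ≤-refl  : ∀ {x} → x ≤ x
    ≤-trans : ∀ {x y z} → x ≤ y → y ≤ z → x ≤ z
    ≤-antisym : ∀ {x y} → x ≤ y → y ≤ x → x ≡ y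
    𝟘 𝟙     : Carrier
    𝟘-min   : ∀ {x} → 𝟘 ≤ x
    𝟙-max   : ∀ {x} → x ≤ 𝟙
    _⊓_     : Carrier → Carrier → Carrier
    ⊓-lb₁   : ∀ {x y} → x ⊓ y ≤ x
    ⊓-lb₂   : ∀ {x y} → x ⊓ y ≤ y
    ⊓-glb   : ∀ {x y z} → z ≤ x → z ≤ y → z ≤ x ⊓ y
    ⋁       : {A : Set} → (A → Carrier) → Carrier
    ⋁-ub    : ∀ {A : Set} (f : A → Carrier) (a : A) → f a ≤ ⋁ f
    ⋁-lub   : ∀ {A : Set} (f : A → Carrier) {z} → (∀ a → f a ≤ z) → ⋁ f ≤ z

module _ (I : UnitInterval) where
  open UnitInterval I

  FuzzySet : Set → Set
  FuzzySet S = S → Carrier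

  _≗F_ : {S : Set} → FuzzySet S → FuzzySet S → Set
  μ ≗F η = ∀ s → μ s ≡ η s

  _≤F_ : {S : Set} → FuzzySet S → FuzzySet S → Set
  μ ≤F η = ∀ s → μ s ≤ η s

  -- a fuzzy topology τ on a set S (τ given as a predicate on S → [0,1];
  -- membership is extensional, as for a set of maps)
  record FuzzyTopology (S : Set) : Set₁ where
    field
      Open      : FuzzySet S → Set
      Open-ext  : ∀ {μ η} → μ ≗F η → Open μ → Open η
      Open-𝟘    : Open (λ _ → 𝟘)
      Open-𝟙    : Open (λ _ → 𝟙)
      Open-⊓    : ∀ {μ η} → Open μ → Open η → Open (λ s → μ s ⊓ η s)
      Open-⋁    : ∀ {A : Set} (μ : A → FuzzySet S) →
                  (∀ a → Open (μ a)) → Open (λ s → ⋁ (λ a → μ a s))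

  FTS : Set₁
  FTS = Σ Set FuzzyTopology

  ∣_∣ : FTS → Set
  ∣ X ∣ = proj₁ X

  Opn : (X : FTS) → FuzzySet ∣ X ∣ → Set
  Opn X = FuzzyTopology.Open (proj₂ X)

  IsFuzzyContinuous : (X Y : FTS) → (∣ X ∣ → ∣ Y ∣) → Set
  IsFuzzyContinuous X Y f = ∀ μ → Opn Y μ → Opn X (μ ∘ f)

  record Hom (X Y : FTS) : Set where
    constructor mkHom
    field
      fun  : ∣ X ∣ → ∣ Y ∣
      cont : IsFuzzyContinuous X Y fun
  open Hom public

  idH : (X : FTS) → Hom X X
  idH X = mkHom id (λ μ o → o)

  _∘H_ : {X Y Z : FTS} → Hom Y Z → Hom X Y → Hom X Z
  mkHom g cg ∘H mkHom f cf = mkHom (g ∘ f) (λ μ o → cf (μ ∘ g) (cg μ o))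

  _≈H_ : {X Y : FTS} → Hom X Y → Hom X Y → Set
  f ≈H g = ∀ x → fun f x ≡ fun g x

  record Endofunctor : Set₁ where
    field
      F₀     : FTS → FTS
      F₁     : {X Y : FTS} → Hom X Y → Hom (F₀ X) (F₀ Y)
      F-resp : {X Y : FTS} {f g : Hom X Y} → f ≈H g → F₁ f ≈H F₁ g
      F-id   : {X : FTS} → F₁ (idH X) ≈H idH (F₀ X)
      F-∘    : {X Y Z : FTS} (g : Hom Y Z) (f : Hom X Y) →
               F₁ (g ∘H f) ≈H (F₁ g ∘H F₁ f)

  Q : FTS → Set
  Q X = Σ (FuzzySet ∣ X ∣) (Opn X)

  Q₁ : {X Y : FTS} → Hom X Y → Q Y → Q X
  Q₁ f (μ , o) = (μ ∘ fun f) , cont f μ o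

  module _ (T : Endofunctor) where
    open Endofunctor T

    record PredicateLifting (n : ℕ) : Set₁ where
      field
        lift    : (X : FTS) → (Fin n → Q X) → Q (F₀ X)
        -- Q^n(X) and Q(T X) are sets of maps; the component is a function
        -- on them, so it respects extensional equality of its arguments
        lift-ext : (X : FTS) (μs νs : Fin n → Q X) →
                   (∀ i → proj₁ (μs i) ≗F proj₁ (νs i)) →
                   proj₁ (lift X μs) ≗F proj₁ (lift X νs)
        natural : {X Y : FTS} (f : Hom X Y) (μs : Fin n → Q Y) →
                  proj₁ (lift X (λ i → Q₁ f (μs i)))
                    ≗F (proj₁ (lift Y μs) ∘ fun (F₁ f))

    IsMonotone : {n : ℕ} → PredicateLifting n → Set₁
    IsMonotone {n} λ' = (X : FTS) (μs ηs : Fin n → Q X) →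
      (∀ i → proj₁ (μs i) ≤F proj₁ (ηs i)) →
      proj₁ (PredicateLifting.lift λ' X μs) ≤F proj₁ (PredicateLifting.lift λ' X ηs)

    record Signature : Set₁ where
      field
        Index : Set
        arity : Index → ℕ
        lifting : (i : Index) → PredicateLifting (arity i)

    IsMonotoneSignature : Signature → Set₁
    IsMonotoneSignature Σ' = ∀ i → IsMonotone (Signature.lifting Σ' i)

    record Model (Φ : Set) : Set₁ where
      field
        B : FTS
        γ : Hom B (F₀ B)
        V : Φ → Q B

    module _ {Φ : Set} (M₁ M₂ : Model Φ) where
      private
        module M₁ = Model M₁
        module M₂ = Model M₂
        B₁ = ∣ M₁.B ∣
        B₂ = ∣ M₂.B ∣

      Rel : Set₁
      Rel = B₁ → B₂ → Set

      Graph : Rel → Set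
      Graph R = Σ[ p ∈ B₁ × B₂ ] R (proj₁ p) (proj₂ p)

      ValuationsAgree : Rel → Set
      ValuationsAgree R = ∀ b₁ b₂ → R b₁ b₂ → ∀ p →
        proj₁ (M₁.V p) b₁ ≡ proj₁ (M₂.V p) b₂

      record IsAMBisimulation (R : Rel) : Set₁ where
        field
          valuations : ValuationsAgree R
          topology   : FuzzyTopology (Graph R)
        Rsp : FTS
        Rsp = Graph R , topology
        field
          π₁-cont : IsFuzzyContinuous Rsp M₁.B (λ r → proj₁ (proj₁ r))
          π₂-cont : IsFuzzyContinuous Rsp M₂.B (λ r → proj₂ (proj₁ r))
        π₁ : Hom Rsp M₁.B
        π₁ = mkHom (λ r → proj₁ (proj₁ r)) π₁-cont
        π₂ : Hom Rsp M₂.B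
        π₂ = mkHom (λ r → proj₂ (proj₁ r)) π₂-cont
        field
          γ*    : Hom Rsp (F₀ Rsp)
          comm₁ : (M₁.γ ∘H π₁) ≈H (F₁ π₁ ∘H γ*)
          comm₂ : (M₂.γ ∘H π₂) ≈H (F₁ π₂ ∘H γ*)

      image : (R : Rel) → FuzzySet B₁ → FuzzySet B₂
      image R μ d' = ⋁ {Σ[ d ∈ B₁ ] R d d'} (λ x → μ (proj₁ x))

      preimage : (R : Rel) → FuzzySet B₂ → FuzzySet B₁
      preimage R η d = ⋁ {Σ[ d' ∈ B₂ ] R d d'} (λ x → η (proj₁ x))

      IsΣBisimulation : Signature → Rel → Set
      IsΣBisimulation Σ' R =
        ValuationsAgree R ×
        (∀ b₁ b₂ → R b₁ b₂ →
          (i : Signature.Index Σ') →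
          (μs : Fin (Signature.arity Σ' i) → Q M₁.B) →
          (ηs : Fin (Signature.arity Σ' i) → Q M₂.B) →
          (∀ k → image R (proj₁ (μs k)) ≤F proj₁ (ηs k)) →
          (∀ k → preimage R (proj₁ (ηs k)) ≤F proj₁ (μs k)) →
          proj₁ (PredicateLifting.lift (Signature.lifting Σ' i) M₁.B μs) (fun M₁.γ b₁)
            ≡ proj₁ (PredicateLifting.lift (Signature.lifting Σ' i) M₂.B ηs) (fun M₂.γ b₂))

{-# OPTIONS --safe #-}
-- Both sides of the Σ-bisimulation condition are pulled back to the relation
-- itself: by the two commuting squares of the Aczel–Mendler bisimulation and
-- naturality of the lifting, λ(μs)(γ₁ b₁) = λ(μs ∘ π₁)(γ* r) and
-- λ(ηs)(γ₂ b₂) = λ(ηs ∘ π₂)(γ* r) for r = (b₁ , b₂).  The two bounds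
-- R[μ] ≤ η and R⁻¹[η] ≤ μ force μ ∘ π₁ = η ∘ π₂ on R, so the two values
-- agree.
module Submission where

open import Data.Nat using (ℕ)
open import Data.Fin using (Fin)
open import Data.Product using (_,_; proj₁)
open import Relation.Binary.PropositionalEquality using (_≡_; cong; sym; module ≡-Reasoning)

open import Defs

module _ (I : UnitInterval) (T : Endofunctor I) {Φ : Set} {M₁ M₂ : Model I T Φ}
         {R : Rel I T M₁ M₂} (am : IsAMBisimulation I T M₁ M₂ R) where

  open UnitInterval I
  open Endofunctor T
  open IsAMBisimulation am
  private
    module M₁ = Model M₁
    module M₂ = Model M₂

  image-preimage-bounded⇒agree-on-graph :
    (μ : FuzzySet I (∣_∣ I M₁.B)) (η : FuzzySet I (∣_∣ I M₂.B)) →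
    _≤F_ I (image I T M₁ M₂ R μ) η → _≤F_ I (preimage I T M₁ M₂ R η) μ →
    _≗F_ I (λ r → μ (fun π₁ r)) (λ r → η (fun π₂ r))
  image-preimage-bounded⇒agree-on-graph μ η im≤η pre≤μ ((b₁ , b₂) , rb) =
    ≤-antisym (≤-trans (⋁-ub (λ x → μ (proj₁ x)) (b₁ , rb)) (im≤η b₂))
              (≤-trans (⋁-ub (λ x → η (proj₁ x)) (b₂ , rb)) (pre≤μ b₁))

  lifting-agrees-along-AMBisimulation :
    {n : ℕ} (λ' : PredicateLifting I T n) (μs : Fin n → Q I M₁.B) (ηs : Fin n → Q I M₂.B) →
    (∀ k → _≗F_ I (λ r → proj₁ (μs k) (fun π₁ r)) (λ r → proj₁ (ηs k) (fun π₂ r))) →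
    ∀ b₁ b₂ (rb : R b₁ b₂) →
    proj₁ (PredicateLifting.lift λ' M₁.B μs) (fun M₁.γ b₁)
      ≡ proj₁ (PredicateLifting.lift λ' M₂.B ηs) (fun M₂.γ b₂)
  lifting-agrees-along-AMBisimulation λ' μs ηs agree b₁ b₂ rb =
    begin
      proj₁ (lift M₁.B μs) (fun M₁.γ b₁)
    ≡⟨ cong (proj₁ (lift M₁.B μs)) (comm₁ r) ⟩
      proj₁ (lift M₁.B μs) (fun (F₁ π₁) (fun γ* r))
    ≡⟨ sym (natural π₁ μs (fun γ* r)) ⟩
      proj₁ (lift Rsp (λ k → Q₁ I π₁ (μs k))) (fun γ* r)
    ≡⟨ lift-ext Rsp _ _ agree (fun γ* r) ⟩
      proj₁ (lift Rsp (λ k → Q₁ I π₂ (ηs k))) (fun γ* r)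
    ≡⟨ natural π₂ ηs (fun γ* r) ⟩
      proj₁ (lift M₂.B ηs) (fun (F₁ π₂) (fun γ* r))
    ≡⟨ cong (proj₁ (lift M₂.B ηs)) (comm₂ r) ⟨
      proj₁ (lift M₂.B ηs) (fun M₂.γ b₂)
    ∎
    where
    open ≡-Reasoning
    open PredicateLifting λ'
    r : Graph I T M₁ M₂ R
    r = (b₁ , b₂) , rb

corollary5p7 : (I : UnitInterval) (T : Endofunctor I) (Σ' : Signature I T) →
    IsMonotoneSignature I T Σ' →
    {Φ : Set} (M₁ M₂ : Model I T Φ) (R : Rel I T M₁ M₂) →
    IsAMBisimulation I T M₁ M₂ R → IsΣBisimulation I T M₁ M₂ Σ' R
corollary5p7 I T Σ' _ M₁ M₂ R am =
  IsAMBisimulation.valuations am ,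
  λ b₁ b₂ rb i μs ηs im≤η pre≤μ →
    lifting-agrees-along-AMBisimulation I T am (Signature.lifting Σ' i) μs ηs
      (λ k → image-preimage-bounded⇒agree-on-graph I T am
               (proj₁ (μs k)) (proj₁ (ηs k)) (im≤η k) (pre≤μ k))
      b₁ b₂ rb
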